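{- Let $\mathcal{F}=(W,\preccurlyeq,V_{\mathcal{F}})$ be a finite poset model. For all $w_1,w_2\in W$: $w_1\equiv_\eta w_2$ in $\mathcal{F}$ if and only if the states $[w_1]_{\rightleftharpoons}$ and $[w_2]_{\rightleftharpoons}$ are strongly bisimilar in the LTS $\mathcal{L}_A(\mathcal{F})$.
   Context: $\mathcal{F}$: finite partial order $(W,\preccurlyeq)$ with valuation $V_{\mathcal{F}}:PL\to2^W$; write $V^{ -1}(w)=\{p: w\in V_{\mathcal{F}}(p)\}$, and $w\leftrightarrow w'$ for "$w\preccurlyeq w'$ or $w'\preccurlyeq w$". An undirected path of length $\ell$ is $\pi:\{0,\dots,\ell\}\to W$ with $\pi(i)\leftrightarrow\pi(i+1)$ for all $i<\ell$; a $\pm$-path is one with $\ell\ge2$, $\pi(0)\preccurlyeq\pi(1)$ and $\pi(\ell)\preccurlyeq\pi(\ell-1)$. $\mathrm{SLCS}_\eta$: $\Phi::=p\mid\neg\Phi\mid\Phi_1\wedge\Phi_2\mid\eta(\Phi_1,\Phi_2)$ with $w\models\eta(\Phi_1,\Phi_2)$ iff some $\pm$-path $\pi$ of length $\ell$ with $\pi(0)=w$ has $\pi(\ell)\models\Phi_2$ and $\pi(i)\models\Phi_1$ for $i<\ell$ (atoms and Boolean connectives standard); $w_1\equiv_\eta w_2$ iff they satisfy the same formulas. Relation $w_1\rightleftharpoons w_2$ holds iff there is an undirected path from $w_1$ to $w_2$ all of whose elements have the same set $V^{ -1}(\cdot)$; it is an equivalence relation with classes $[w]_{\rightleftharpoons}$.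 The LTS $\mathcal{L}_A(\mathcal{F})$ has states $W/{\rightleftharpoons}$, labels $2^{PL}\cup\{\mathbf{s},\mathbf{d}\}$ ($\mathbf{s},\mathbf{d}\notin PL$), and is the smallest transition relation with: $[w]\xrightarrow{V^{ -1}(w)}[w]$ for every $w$; $[w]\xrightarrow{\mathbf{s}}[w']$ whenever $w\leftrightarrow w'$; $[w]\xrightarrow{\mathbf{d}}[w']$ whenever $w'\preccurlyeq w$. A strong bisimulation on an LTS is a relation $B$ such that if $B(s_1,s_2)$ and $s_1\xrightarrow{\lambda}s_1'$ then $s_2\xrightarrow{\lambda}s_2'$ with $B(s_1',s_2')$, and symmetrically; strongly bisimilar means related by some strong bisimulation. -}

module Defs where

open import Level using (0ℓ)
open import Data.Nat using (ℕ; zero; suc; _<_; _≤_; pred)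
open import Data.Fin using (Fin)
open import Data.Product using (Σ; ∃; ∃-syntax; _×_; _,_)
open import Data.Sum using (_⊎_)
open import Relation.Nullary using (¬_)
open import Relation.Binary.PropositionalEquality using (_≡_)
open import Relation.Binary.Structures using (IsPartialOrder)

-- W is the finite carrier Fin n; the valuation V_F : PL → 2^W is given as
-- a family of predicates  V p : Fin n → Set  (w ∈ V_F(p)  iff  V p w).
record PosetModel (PL : Set) (n : ℕ) : Set₁ where
  field
    _≼_  : Fin n → Fin n → Set
    isPO : IsPartialOrder _≡_ _≼_
    V    : PL → Fin n → Set

data Formula (PL : Set) : Set where
  atom : PL → Formula PL
  neg  : Formula PL → Formula PL
  and  : Formula PL → Formula PL → Formula PL
  eta  : Formula PL → Formula PL → Formula PL

-- Labels of the LTS L_A(F): 2^PL ∪ {s, d}.  A subset of PL is a predicate.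
data Label (PL : Set) : Set₁ where
  lab : (PL → Set) → Label PL
  s   : Label PL
  d   : Label PL

module _ {PL : Set} {n : ℕ} (M : PosetModel PL n) where
  open PosetModel M

  W : Set
  W = Fin n

  Conn : W → W → Set
  Conn w w' = (w ≼ w') ⊎ (w' ≼ w)

  -- undirected path π of length ℓ (only π 0 … π ℓ matter)
  UPath : ℕ → (ℕ → W) → Set
  UPath ℓ π = ∀ i → i < ℓ → Conn (π i) (π (suc i))

  PMPath : ℕ → (ℕ → W) → Set
  PMPath ℓ π = UPath ℓ π × 2 ≤ ℓ × (π 0 ≼ π 1) × (π ℓ ≼ π (pred ℓ))

  _⊨_ : W → Formula PL → Set
  w ⊨ atom p  = V p w
  w ⊨ neg Φ   = ¬ (w ⊨ Φ)
  w ⊨ and Φ Ψ = (w ⊨ Φ) × (w ⊨ Ψ)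
  w ⊨ eta Φ Ψ = ∃[ ℓ ] ∃[ π ] (PMPath ℓ π × π 0 ≡ w × (π ℓ ⊨ Ψ)
                               × (∀ i → i < ℓ → π i ⊨ Φ))

  EtaEquiv : W → W → Set
  EtaEquiv w₁ w₂ = ∀ Φ → ((w₁ ⊨ Φ) → (w₂ ⊨ Φ)) × ((w₂ ⊨ Φ) → (w₁ ⊨ Φ))

  SameSet : (PL → Set) → (PL → Set) → Set
  SameSet S T = ∀ p → (S p → T p) × (T p → S p)

  Vinv : W → PL → Set
  Vinv w p = V p w

  -- w₁ ⇌ w₂ : undirected path from w₁ to w₂ all of whose elements have the
  -- same set V^{-1}(·) (equivalently: the same set as w₁)
  _⇌_ : W → W → Set
  w₁ ⇌ w₂ = ∃[ ℓ ] ∃[ π ] (UPath ℓ π × π 0 ≡ w₁ × π ℓ ≡ w₂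
                           × (∀ i → i ≤ ℓ → SameSet (Vinv (π i)) (Vinv w₁)))

  -- Transitions of L_A(F), with each state [x]_⇌ represented by any x;
  -- [x] --λ--> [y] holds iff some generating rule applies to members of the
  -- classes [x] and [y].
  data Step : W → Label PL → W → Set₁ where
    stepV : ∀ {x y w} (S : PL → Set) → x ⇌ w → y ⇌ w →
            SameSet S (Vinv w) → Step x (lab S) y
    stepS : ∀ {x y w w'} → x ⇌ w → y ⇌ w' → Conn w w' → Step x s y
    stepD : ∀ {x y w w'} → x ⇌ w → y ⇌ w' → w' ≼ w → Step x d y

  IsBisimulation : (W → W → Set) → Set₁
  IsBisimulation B =
    (∀ x y → B x y → ∀ (λ' : Label PL) x' → Step x λ' x' →
       ∃[ y' ] (Step y λ' y' × B x' y'))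
    × (∀ x y → B x y → ∀ (λ' : Label PL) y' → Step y λ' y' →
       ∃[ x' ] (Step x λ' x' × B x' y'))

  StronglyBisimilar : W → W → Set₁
  StronglyBisimilar x y = Σ (W → W → Set) λ B → IsBisimulation B × B x y

-- Up to repeating its first point, a ±-path is a walk followed by one downward step, so
-- η(Φ, Ψ) holds at x iff a Φ-walk leads from x to some u with a Ψ-state below u.  The s- and
-- d-transitions of the LTS simulate such walks class by class, hence bisimilar states satisfy
-- the same formulas.  Conversely, on a finite model every set of states that can be separated
-- from each state outside it is definable by a finite conjunction; in particular so are the
-- valuation class of x (by χ) and the ≡η-class of any state.  The formulas η(χ ∨ Φ, Φ) and
-- η(χ, Φ) then say "[x] has an s-successor (a d-successor) satisfying Φ", which makes ≡η a
-- bisimulation.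
module Submission where

open import Defs
open import Level using (0ℓ)
open import Data.Nat using (ℕ)
open import Data.Fin using (Fin)
open import Data.Product using (_×_)
open import Axiom.ExcludedMiddle using (ExcludedMiddle)

open import Axiom.DoubleNegationElimination using (em⇒dne)
open import Data.Empty using (⊥-elim)
open import Data.Fin using (zero; suc)
open import Data.Nat using (zero; suc; _≤_; z≤n; s≤s)
open import Data.Nat.Properties using (m<n⇒m<1+n; ≤-pred)
open import Data.Product using (∃-syntax; _,_; proj₁; proj₂)
open import Data.Sum using (inj₁; inj₂)
open import Function.Base using (flip)
open import Relation.Binary.PropositionalEquality using (_≡_; refl; sym; subst; subst₂)
open import Relation.Binary.Structures using (IsPartialOrder)
open import Relation.Nullary using (¬_; yes; no)

module _ {PL : Set} {n : ℕ} (M : PosetModel PL n) where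
  open PosetModel M

  infix 4 _⊩_ _↔_ _∼_ _≐_
  infixr 6 _∨ᶠ_

  _⊩_ : Fin n → Formula PL → Set
  _⊩_ = _⊨_ M

  _↔_ : Fin n → Fin n → Set
  _↔_ = Conn M

  _∼_ : Fin n → Fin n → Set
  _∼_ = _⇌_ M

  _≐_ : Fin n → Fin n → Set
  a ≐ b = SameSet M (Vinv M a) (Vinv M b)

  private variable
    x y z u v a : Fin n
    Q R : Fin n → Set
    S₁ S₂ S₃ : PL → Set
    Φ Ψ χ : Formula PL
    B : Fin n → Fin n → Set
    l : Label PL

  ≼-refl : x ≼ x
  ≼-refl = IsPartialOrder.refl isPO

  ↔-refl : x ↔ x
  ↔-refl = inj₁ ≼-refl

  ↔-sym : x ↔ y → y ↔ x
  ↔-sym (inj₁ x≼y) = inj₂ x≼y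
  ↔-sym (inj₂ y≼x) = inj₁ y≼x

  sameSet-refl : SameSet M S₁ S₁
  sameSet-refl p = (λ s → s) , (λ s → s)

  sameSet-sym : SameSet M S₁ S₂ → SameSet M S₂ S₁
  sameSet-sym S₁≐S₂ p = proj₂ (S₁≐S₂ p) , proj₁ (S₁≐S₂ p)

  sameSet-trans : SameSet M S₁ S₂ → SameSet M S₂ S₃ → SameSet M S₁ S₃
  sameSet-trans S₁≐S₂ S₂≐S₃ p =
    (λ s₁ → proj₁ (S₂≐S₃ p) (proj₁ (S₁≐S₂ p) s₁)) , (λ s₃ → proj₂ (S₁≐S₂ p) (proj₂ (S₂≐S₃ p) s₃))

  data Walk (Q : Fin n → Set) : Fin n → Fin n → Set where
    [_]    : Q x → Walk Q x x
    _∷⟨_⟩_ : Q x → x ↔ y → Walk Q y z → Walk Q x z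

  length : Walk Q x y → ℕ
  length [ _ ]        = 0
  length (_ ∷⟨ _ ⟩ w) = suc (length w)

  head : Walk Q x y → Q x
  head [ q ]        = q
  head (q ∷⟨ _ ⟩ _) = q

  last : Walk Q x y → Q y
  last [ q ]        = q
  last (_ ∷⟨ _ ⟩ w) = last w

  map : (∀ {t} → Q t → R t) → Walk Q x y → Walk R x y
  map f [ q ]        = [ f q ]
  map f (q ∷⟨ c ⟩ w) = f q ∷⟨ c ⟩ map f w

  _++_ : Walk Q x y → Walk Q y z → Walk Q x z
  [ _ ]        ++ w′ = w′
  (q ∷⟨ c ⟩ w) ++ w′ = q ∷⟨ c ⟩ (w ++ w′)

  _∷ʳ⟨_⟩_ : Walk Q x y → y ↔ z → Q z → Walk Q x z
  [ q ]        ∷ʳ⟨ c′ ⟩ q′ = q ∷⟨ c′ ⟩ [ q′ ]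
  (q ∷⟨ c ⟩ w) ∷ʳ⟨ c′ ⟩ q′ = q ∷⟨ c ⟩ (w ∷ʳ⟨ c′ ⟩ q′)

  reverse : Walk Q x y → Walk Q y x
  reverse [ q ]        = [ q ]
  reverse (q ∷⟨ c ⟩ w) = reverse w ∷ʳ⟨ ↔-sym c ⟩ q

  toPath : Walk Q x y → Fin n → ℕ → Fin n
  toPath {x = x} w next zero = x
  toPath [ _ ]        next (suc i) = next
  toPath (_ ∷⟨ _ ⟩ w) next (suc i) = toPath w next i

  toPath-last : (w : Walk Q x y) → toPath w v (length w) ≡ y
  toPath-last [ _ ]        = refl
  toPath-last (_ ∷⟨ _ ⟩ w) = toPath-last w

  toPath-next : (w : Walk Q x y) → toPath w v (suc (length w)) ≡ v
  toPath-next [ _ ]        = refl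
  toPath-next (_ ∷⟨ _ ⟩ w) = toPath-next w

  toPath-upath : (w : Walk Q x y) → y ↔ v → UPath M (suc (length w)) (toPath w v)
  toPath-upath [ _ ]        y↔v zero    _         = y↔v
  toPath-upath [ _ ]        y↔v (suc i) (s≤s ())
  toPath-upath (_ ∷⟨ c ⟩ w) y↔v zero    _         = c
  toPath-upath (_ ∷⟨ _ ⟩ w) y↔v (suc i) (s≤s i<) = toPath-upath w y↔v i i<

  toPath-all : (w : Walk Q x y) → ∀ i → i ≤ length w → Q (toPath w v i)
  toPath-all w            zero    _         = head w
  toPath-all (_ ∷⟨ _ ⟩ w) (suc i) (s≤s i≤) = toPath-all w i i≤

  UPath-pred : ∀ {ℓ π} → UPath M (suc ℓ) π → UPath M ℓ π
  UPath-pred up i i<ℓ = up i (m<n⇒m<1+n i<ℓ)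

  fromPath : ∀ ℓ π → UPath M ℓ π → (∀ i → i ≤ ℓ → Q (π i)) → Walk Q (π 0) (π ℓ)
  fromPath zero    π up q = [ q 0 z≤n ]
  fromPath (suc ℓ) π up q =
    q 0 z≤n ∷⟨ up 0 (s≤s z≤n) ⟩
    fromPath ℓ (λ i → π (suc i)) (λ i i< → up (suc i) (s≤s i<)) (λ i i≤ → q (suc i) (s≤s i≤))

  ∼⇒walk : x ∼ y → Walk (_≐ x) x y
  ∼⇒walk (ℓ , π , up , refl , refl , same) = fromPath ℓ π up same

  walk⇒∼ : Walk (_≐ x) x y → x ∼ y
  walk⇒∼ {y = y} w =
    length w , toPath w y , UPath-pred (toPath-upath w ↔-refl) , refl , toPath-last w , toPath-all w

  ∼-refl : x ∼ x
  ∼-refl = walk⇒∼ [ sameSet-refl ]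

  ∼⇒≐ : x ∼ y → y ≐ x
  ∼⇒≐ x∼y = last (∼⇒walk x∼y)

  ∼-sym : x ∼ y → y ∼ x
  ∼-sym x∼y = walk⇒∼ (map (λ t≐x → sameSet-trans t≐x (sameSet-sym (∼⇒≐ x∼y))) (reverse (∼⇒walk x∼y)))

  ∼-trans : x ∼ y → y ∼ z → x ∼ z
  ∼-trans x∼y y∼z = walk⇒∼ (∼⇒walk x∼y ++ map (λ t≐y → sameSet-trans t≐y (∼⇒≐ x∼y)) (∼⇒walk y∼z))

  ↔⇒∼ : y ≐ x → x ↔ y → x ∼ y
  ↔⇒∼ y≐x x↔y = walk⇒∼ (sameSet-refl ∷⟨ x↔y ⟩ [ y≐x ])

  ∼⇒walk-within : x ∼ y → Walk (x ∼_) x y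
  ∼⇒walk-within {x = x} x∼y = go ∼-refl (∼⇒walk x∼y)
    where
    go : x ∼ a → Walk (_≐ x) a z → Walk (x ∼_) a z
    go x∼a [ _ ]            = [ x∼a ]
    go x∼a (a≐x ∷⟨ c ⟩ rest) =
      x∼a ∷⟨ c ⟩ go (∼-trans x∼a (↔⇒∼ (sameSet-trans (head rest) (sameSet-sym a≐x)) c)) rest

  Step-resp-∼ : x ∼ y → Step M x l z → Step M y l z
  Step-resp-∼ x∼y (stepV S x∼w z∼w S≐w)  = stepV S (∼-trans (∼-sym x∼y) x∼w) z∼w S≐w
  Step-resp-∼ x∼y (stepS x∼w z∼w′ w↔w′) = stepS (∼-trans (∼-sym x∼y) x∼w) z∼w′ w↔w′
  Step-resp-∼ x∼y (stepD x∼w z∼w′ w′≼w) = stepD (∼-trans (∼-sym x∼y) x∼w) z∼w′ w′≼w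

  ∼-isBisimulation : IsBisimulation M _∼_
  ∼-isBisimulation = (λ x y x∼y l x′ st → x′ , Step-resp-∼ x∼y st , ∼-refl)
                   , (λ x y x∼y l y′ st → y′ , Step-resp-∼ (∼-sym x∼y) st , ∼-refl)

  IsBisimulation-flip : IsBisimulation M B → IsBisimulation M (flip B)
  IsBisimulation-flip (forth , back) = (λ x y → back y x) , (λ x y → forth y x)

  EtaWitness : Formula PL → Formula PL → Fin n → Set
  EtaWitness Φ Ψ x = ∃[ u ] ∃[ v ] (Walk (_⊩ Φ) x u × v ≼ u × v ⊩ Ψ)

  eta⇒witness : ∀ Φ Ψ → x ⊩ eta Φ Ψ → EtaWitness Φ Ψ x
  eta⇒witness Φ Ψ (suc (suc m) , π , (up , s≤s (s≤s _) , _ , π₂≼π₁) , refl , ψ , φ) =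
    π (suc m) , π (suc (suc m)) , fromPath (suc m) π (UPath-pred up) (λ i i≤ → φ i (s≤s i≤)) , π₂≼π₁ , ψ

  -- The ±-path repeats x once, so that its first step x ≼ x is upward.
  witness⇒eta : ∀ Φ Ψ → EtaWitness Φ Ψ x → x ⊩ eta Φ Ψ
  witness⇒eta {x = x} Φ Ψ (u , v , w , v≼u , ψ) =
    suc (suc (length w)) , toPath xw v ,
    (toPath-upath xw (inj₂ v≼u) , s≤s (s≤s z≤n) , ≼-refl ,
     subst₂ _≼_ (sym (toPath-next w)) (sym (toPath-last w)) v≼u) ,
    refl , subst (_⊩ Ψ) (sym (toPath-next w)) ψ , (λ i i< → toPath-all xw i (≤-pred i<))
    where
    xw : Walk (_⊩ Φ) x u
    xw = head w ∷⟨ ↔-refl ⟩ w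

  -- Soundness.

  Invariant : Formula PL → Set₁
  Invariant Φ = ∀ {B} → IsBisimulation M B → ∀ {x y} → B x y → x ⊩ Φ → y ⊩ Φ

  ∼-walk-within : ∀ Φ → Invariant Φ → x ∼ y → x ⊩ Φ → Walk (_⊩ Φ) x y
  ∼-walk-within Φ invΦ x∼y φ = map (λ x∼t → invΦ ∼-isBisimulation x∼t φ) (∼⇒walk-within x∼y)

  -- Each ↔-step of the walk is matched by an s-transition and the final ≼ by a d-transition;
  -- walks inside the ⇌-classes reached glue the matching steps together.
  witness-transfer : ∀ Φ Ψ → Invariant Φ → Invariant Ψ → IsBisimulation M B →
                     B x y → Walk (_⊩ Φ) x u → v ≼ u → v ⊩ Ψ → EtaWitness Φ Ψ y
  witness-transfer {v = v} Φ Ψ invΦ invΨ bis@(forth , _) b [ φ ] v≼u ψ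
    with forth _ _ b d v (stepD ∼-refl ∼-refl v≼u)
  ... | _ , stepD {w = w} {w′} y∼w v′∼w′ w′≼w , b′ =
    w , w′ , ∼-walk-within Φ invΦ y∼w (invΦ bis b φ) , w′≼w ,
    invΨ ∼-isBisimulation v′∼w′ (invΨ bis b′ ψ)
  witness-transfer Φ Ψ invΦ invΨ bis@(forth , _) b (φ ∷⟨ c ⟩ rest) v≼u ψ
    with forth _ _ b s _ (stepS ∼-refl ∼-refl c)
  ... | _ , stepS {w = w} y∼w y₁∼w′ w↔w′ , b₁
    with witness-transfer Φ Ψ invΦ invΨ bis b₁ rest v≼u ψ
  ... | u′ , v′ , rest′ , v′≼u′ , ψ′ =
    u′ , v′ ,
    ∼-walk-within Φ invΦ y∼w φy ++ (φw ∷⟨ w↔w′ ⟩ (reverse (∼-walk-within Φ invΦ y₁∼w′ φy₁) ++ rest′)) ,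
    v′≼u′ , ψ′
    where
    φy  = invΦ bis b φ
    φw  = invΦ ∼-isBisimulation y∼w φy
    φy₁ = invΦ bis b₁ (head rest)

  preserves : ∀ Φ → Invariant Φ
  -- The self-loop of [x] labelled V⁻¹(x) must be matched by one of [y].
  preserves (atom p) (forth , _) {x} {y} b x⊩p
    with forth x y b (lab (Vinv M x)) x (stepV (Vinv M x) ∼-refl ∼-refl sameSet-refl)
  ... | _ , stepV _ y∼w _ S≐w , _ = proj₁ (∼⇒≐ y∼w p) (proj₁ (S≐w p) x⊩p)
  preserves (neg Φ)   bis b ¬φ       = λ φ → ¬φ (preserves Φ (IsBisimulation-flip bis) b φ)
  preserves (and Φ Ψ) bis b (φ , ψ)  = preserves Φ bis b φ , preserves Ψ bis b ψ
  preserves (eta Φ Ψ) bis b x⊩η      =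
    let (u , v , w , v≼u , ψ) = eta⇒witness Φ Ψ x⊩η
    in witness⇒eta Φ Ψ (witness-transfer Φ Ψ (preserves Φ) (preserves Ψ) bis b w v≼u ψ)

  bisimilar⇒≡η : StronglyBisimilar M x y → EtaEquiv M x y
  bisimilar⇒≡η (B , bis , b) Φ = preserves Φ bis b , preserves Φ (IsBisimulation-flip bis) b

  ∼⇒≡η : x ∼ y → EtaEquiv M x y
  ∼⇒≡η x∼y = bisimilar⇒≡η (_∼_ , ∼-isBisimulation , x∼y)

  -- Definability.

  _∨ᶠ_ : Formula PL → Formula PL → Formula PL
  Φ ∨ᶠ Ψ = neg (and (neg Φ) (neg Ψ))

  -- PL may be empty, so no formula is true everywhere outright; ⊤ᶠ Φ is built from a given Φ.
  ⊤ᶠ : Formula PL → Formula PL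
  ⊤ᶠ Φ = Φ ∨ᶠ neg Φ

  ⊤ᶠ-true : ∀ Φ → x ⊩ ⊤ᶠ Φ
  ⊤ᶠ-true Φ (¬φ , ¬¬φ) = ¬¬φ ¬φ

  ∨ᶠ-injˡ : ∀ Φ Ψ → x ⊩ Φ → x ⊩ Φ ∨ᶠ Ψ
  ∨ᶠ-injˡ Φ Ψ φ (¬φ , _) = ¬φ φ

  ∨ᶠ-injʳ : ∀ Φ Ψ → x ⊩ Ψ → x ⊩ Φ ∨ᶠ Ψ
  ∨ᶠ-injʳ Φ Ψ ψ (_ , ¬ψ) = ¬ψ ψ

  ⋀ : ∀ {m} → Formula PL → (Fin m → Formula PL) → Formula PL
  ⋀ {zero}  Φ₀ Φ = Φ₀
  ⋀ {suc m} Φ₀ Φ = and (Φ zero) (⋀ Φ₀ (λ i → Φ (suc i)))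

  ⋀-intro : ∀ {m} Φ₀ (Φ : Fin m → Formula PL) → x ⊩ Φ₀ → (∀ i → x ⊩ Φ i) → x ⊩ ⋀ Φ₀ Φ
  ⋀-intro {m = zero}  Φ₀ Φ φ₀ φ = φ₀
  ⋀-intro {m = suc m} Φ₀ Φ φ₀ φ = φ zero , ⋀-intro Φ₀ (λ i → Φ (suc i)) φ₀ (λ i → φ (suc i))

  ⋀-elim : ∀ {m} Φ₀ (Φ : Fin m → Formula PL) → x ⊩ ⋀ Φ₀ Φ → ∀ i → x ⊩ Φ i
  ⋀-elim Φ₀ Φ (φ₀ , _) zero    = φ₀
  ⋀-elim Φ₀ Φ (_ , φ)  (suc i) = ⋀-elim Φ₀ (λ i → Φ (suc i)) φ i

  Defines : Formula PL → (Fin n → Set) → Set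
  Defines Φ P = (∀ {t} → P t → t ⊩ Φ) × (∀ {t} → t ⊩ Φ → P t)

  Separates : Formula PL → (Fin n → Set) → Fin n → Set
  Separates L P z = (∀ {t} → P t → t ⊩ L) × (z ⊩ L → P z)

  definable : Formula PL → (P : Fin n → Set) → (∀ z → ∃[ L ] Separates L P z) → ∃[ Φ ] Defines Φ P
  definable Φ₀ P separate =
    ⋀ (⊤ᶠ Φ₀) L , (λ Pt → ⋀-intro (⊤ᶠ Φ₀) L (⊤ᶠ-true Φ₀) (λ z → proj₁ (proj₂ (separate z)) Pt))
      , (λ {t} tΦ → proj₂ (proj₂ (separate t)) (⋀-elim (⊤ᶠ Φ₀) L tΦ t))
    where
    L : Fin n → Formula PL
    L z = proj₁ (separate z)

  ≡η-refl : EtaEquiv M x x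
  ≡η-refl Φ = (λ φ → φ) , (λ φ → φ)

  ≡η-sym : EtaEquiv M x y → EtaEquiv M y x
  ≡η-sym x≡y Φ = proj₂ (x≡y Φ) , proj₁ (x≡y Φ)

  ≡η-trans : EtaEquiv M x y → EtaEquiv M y z → EtaEquiv M x z
  ≡η-trans x≡y y≡z Φ =
    (λ φ → proj₁ (y≡z Φ) (proj₁ (x≡y Φ) φ)) , (λ φ → proj₂ (x≡y Φ) (proj₂ (y≡z Φ) φ))

  ≡η⇒≐ : EtaEquiv M x y → x ≐ y
  ≡η⇒≐ x≡y p = x≡y (atom p)

  s-successor⇒eta : ∀ χ Φ → (∀ {t} → t ≐ x → t ⊩ χ) → Step M x s z → z ⊩ Φ → x ⊩ eta (χ ∨ᶠ Φ) Φ
  s-successor⇒eta {x = x} χ Φ χ-intro (stepS {w = w} {w′} x∼w z∼w′ w↔w′) φ =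
    witness⇒eta (χ ∨ᶠ Φ) Φ (witness w↔w′)
    where
    φw′ : w′ ⊩ Φ
    φw′ = preserves Φ ∼-isBisimulation z∼w′ φ
    toW : Walk (_⊩ χ ∨ᶠ Φ) x w
    toW = map (λ x∼t → ∨ᶠ-injˡ χ Φ (χ-intro (∼⇒≐ x∼t))) (∼⇒walk-within x∼w)
    witness : w ↔ w′ → EtaWitness (χ ∨ᶠ Φ) Φ x
    witness (inj₁ w≼w′) = w′ , w′ , toW ∷ʳ⟨ inj₁ w≼w′ ⟩ ∨ᶠ-injʳ χ Φ φw′ , ≼-refl , φw′
    witness (inj₂ w′≼w) = w , w′ , toW , w′≼w , φw′

  d-successor⇒eta : ∀ χ Φ → (∀ {t} → t ≐ x → t ⊩ χ) → Step M x d z → z ⊩ Φ → x ⊩ eta χ Φ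
  d-successor⇒eta χ Φ χ-intro (stepD {w = w} {w′} x∼w z∼w′ w′≼w) φ =
    witness⇒eta χ Φ
      (w , w′ , map (λ x∼t → χ-intro (∼⇒≐ x∼t)) (∼⇒walk-within x∼w) , w′≼w ,
       preserves Φ ∼-isBisimulation z∼w′ φ)

  eta⇒d-successor : ∀ χ Φ → (∀ {t} → t ⊩ χ → t ≐ x) → x ⊩ eta χ Φ → ∃[ z ] (Step M x d z × z ⊩ Φ)
  eta⇒d-successor χ Φ χ-elim x⊩η =
    let (u , v , w , v≼u , φ) = eta⇒witness χ Φ x⊩η
    in v , stepD (walk⇒∼ (map χ-elim w)) ∼-refl v≼u , φ

  -- Completeness.

  module _ (em : ExcludedMiddle 0ℓ) where

    dne : {P : Set} → ¬ ¬ P → P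
    dne = em⇒dne em

    ∨ᶠ-resolve : ∀ Φ Ψ → x ⊩ Φ ∨ᶠ Ψ → ¬ x ⊩ Ψ → x ⊩ Φ
    ∨ᶠ-resolve Φ Ψ φ∨ψ ¬ψ = dne (λ ¬φ → φ∨ψ (¬φ , ¬ψ))

    eta⇒s-successor : ∀ χ Φ → (∀ {t} → t ⊩ χ → t ≐ x) → x ⊩ eta (χ ∨ᶠ Φ) Φ →
                      ∃[ z ] (Step M x s z × z ⊩ Φ)
    eta⇒s-successor {x = x} χ Φ χ-elim x⊩η =
      let (u , v , w , v≼u , φv) = eta⇒witness (χ ∨ᶠ Φ) Φ x⊩η in go ∼-refl w v≼u φv
      where
      -- Follow the walk while it stays in [x]; its first point outside [x] satisfies Φ.
      go : x ∼ a → Walk (_⊩ χ ∨ᶠ Φ) a u → v ≼ u → v ⊩ Φ → ∃[ z ] (Step M x s z × z ⊩ Φ)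
      go {v = v} x∼a [ _ ] v≼u φv = v , stepS x∼a ∼-refl (inj₂ v≼u) , φv
      go x∼a (_∷⟨_⟩_ {y = a₁} _ a↔a₁ rest) v≼u φv with em {a₁ ⊩ Φ}
      ... | yes φa₁ = a₁ , stepS x∼a ∼-refl a↔a₁ , φa₁
      ... | no ¬φa₁ = go (∼-trans x∼a (↔⇒∼ a₁≐a a↔a₁)) rest v≼u φv
        where
        a₁≐a = sameSet-trans (χ-elim (∨ᶠ-resolve χ Φ (head rest) ¬φa₁)) (sameSet-sym (∼⇒≐ x∼a))

    distinguish : ¬ EtaEquiv M x y → ∃[ Φ ] (x ⊩ Φ × ¬ y ⊩ Φ)
    distinguish x≢y = dne λ ∄Φ → x≢y λ Φ →
      (λ φ → dne λ ¬φ′ → ∄Φ (Φ , φ , ¬φ′)) , (λ φ′ → dne λ ¬φ → ∄Φ (neg Φ , ¬φ , λ ¬φ′ → ¬φ′ φ′))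

    valuation-class : Formula PL → ∀ x → ∃[ χ ] Defines χ (_≐ x)
    valuation-class Φ₀ x = definable Φ₀ (_≐ x) literal
      where
      literal : ∀ z → ∃[ L ] Separates L (_≐ x) z
      literal z with em {∃[ p ] ¬ ((V p z → V p x) × (V p x → V p z))}
      ... | no ∄p = ⊤ᶠ Φ₀ , (λ _ → ⊤ᶠ-true Φ₀) , (λ _ p → dne (λ z≉x → ∄p (p , z≉x)))
      ... | yes (p , z≉x) with em {V p x}
      ...   | yes px  = atom p , (λ t≐x → proj₂ (t≐x p) px)
                      , (λ pz → ⊥-elim (z≉x ((λ _ → px) , (λ _ → pz))))
      ...   | no ¬px = neg (atom p) , (λ t≐x pt → ¬px (proj₁ (t≐x p) pt))
                      , (λ ¬pz → ⊥-elim (z≉x ((λ pz → ⊥-elim (¬pz pz)) , (λ px → ⊥-elim (¬px px)))))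

    ≡η-class : Formula PL → ∀ x → ∃[ Φ ] Defines Φ (EtaEquiv M x)
    ≡η-class Φ₀ x = definable Φ₀ (EtaEquiv M x) separator
      where
      separator : ∀ z → ∃[ L ] Separates L (EtaEquiv M x) z
      separator z with em {EtaEquiv M x z}
      ... | yes x≡z = ⊤ᶠ Φ₀ , (λ _ → ⊤ᶠ-true Φ₀) , (λ _ → x≡z)
      ... | no x≢z  =
        let (L , xL , ¬zL) = distinguish x≢z
        in L , (λ x≡t → proj₁ (x≡t L) xL) , (λ zL → ⊥-elim (¬zL zL))

    -- The case split only serves to obtain a formula from which ⊤ᶠ can be built.
    realised-type : (S : Fin n → Set₁) → S y → (∀ Φ → x ⊩ Φ → ∃[ z ] (S z × z ⊩ Φ)) →
                    ∃[ z ] (S z × EtaEquiv M x z)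
    realised-type {y = y} {x = x} S Sy realise with em {EtaEquiv M x y}
    ... | yes x≡y = y , Sy , x≡y
    ... | no x≢y  =
      let (Φ₀ , _) = distinguish x≢y
          (Φ , Φ-intro , Φ-elim) = ≡η-class Φ₀ x
          (z , Sz , φz) = realise Φ (Φ-intro ≡η-refl)
      in z , Sz , Φ-elim φz

    ≡η-forth : EtaEquiv M x y → Step M x l z → ∃[ z′ ] (Step M y l z′ × EtaEquiv M z z′)
    ≡η-forth {y = y} x≡y (stepV S x∼w z∼w S≐w) =
      y , stepV S ∼-refl ∼-refl (sameSet-trans S≐w (sameSet-trans (∼⇒≐ x∼w) (≡η⇒≐ x≡y))) ,
      ≡η-trans (∼⇒≡η (∼-trans z∼w (∼-sym x∼w))) x≡y
    ≡η-forth {x = x} {y = y} x≡y x→z@(stepS _ _ _) =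
      realised-type (Step M y s) (stepS ∼-refl ∼-refl ↔-refl) λ Φ φ →
        let (χ , χ-intro , χ-elim) = valuation-class Φ x
        in eta⇒s-successor χ Φ (λ tχ → sameSet-trans (χ-elim tχ) (≡η⇒≐ x≡y))
             (proj₁ (x≡y (eta (χ ∨ᶠ Φ) Φ)) (s-successor⇒eta χ Φ χ-intro x→z φ))
    ≡η-forth {x = x} {y = y} x≡y x→z@(stepD _ _ _) =
      realised-type (Step M y d) (stepD ∼-refl ∼-refl ≼-refl) λ Φ φ →
        let (χ , χ-intro , χ-elim) = valuation-class Φ x
        in eta⇒d-successor χ Φ (λ tχ → sameSet-trans (χ-elim tχ) (≡η⇒≐ x≡y))
             (proj₁ (x≡y (eta χ Φ)) (d-successor⇒eta χ Φ χ-intro x→z φ))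

    ≡η-isBisimulation : IsBisimulation M (EtaEquiv M)
    ≡η-isBisimulation = (λ x y x≡y l x′ → ≡η-forth x≡y)
                      , (λ x y x≡y l y′ y→y′ →
                           let (x′ , x→x′ , y′≡x′) = ≡η-forth (≡η-sym x≡y) y→y′
                           in x′ , x→x′ , ≡η-sym y′≡x′)

    ≡η⇒bisimilar : EtaEquiv M x y → StronglyBisimilar M x y
    ≡η⇒bisimilar x≡y = EtaEquiv M , ≡η-isBisimulation , x≡y

theorem5p6 : ExcludedMiddle 0ℓ → (PL : Set) (n : ℕ) (M : PosetModel PL n)
    → (w₁ w₂ : Fin n)
    → (EtaEquiv M w₁ w₂ → StronglyBisimilar M w₁ w₂)
      × (StronglyBisimilar M w₁ w₂ → EtaEquiv M w₁ w₂)
theorem5p6 em PL n M w₁ w₂ = ≡η⇒bisimilar M em , bisimilar⇒≡η M
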